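{- Let $n\ge 3$ and let $C_n^-$ be the cycle $C_n$ with all edges signed $-1$. Then $\dim(C_n^-)=2$.
   Context: A signed graph is $(G,\sigma)$ with $\sigma:E(G)\to\{+1,-1\}$. The sign of a path is the product of its edge signs; $d$ is the graph distance. In $C_n^-$ all shortest paths between two given vertices have the same sign $\sigma(uv)$, and the signed distance is $d_\Sigma(u,v)=\sigma(uv)d(u,v)$. For an ordered vertex set $W=(w_1,\dots,w_k)$, $r(v|W)=(d_\Sigma(v,w_1),\dots,d_\Sigma(v,w_k))$; $W$ is resolving if distinct vertices have distinct representations; $\dim$ is the minimum cardinality of a resolving set. -}

module Defs where

open import Level using (0ℓ)
open import Data.Nat using (ℕ; zero; suc; _≤_)
open import Data.Fin using (Fin; toℕ)
open import Data.Integer using (ℤ; +_; _*_)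
open import Data.Sign using (Sign) renaming (_*_ to _*ˢ_)
open import Data.Product using (Σ; ∃; _×_; _,_)
open import Data.Sum using (_⊎_)
open import Relation.Binary.PropositionalEquality using (_≡_)
open import Function.Definitions using (Injective)

record SignedGraph (N : ℕ) : Set₁ where
  field
    Adj : Fin N → Fin N → Set
    σ   : ∀ {u v} → Adj u v → Sign

module _ {N : ℕ} (G : SignedGraph N) where
  open SignedGraph G

  data Walk : Fin N → Fin N → Set where
    []  : ∀ {u} → Walk u u
    _∷_ : ∀ {u w v} → Adj u w → Walk w v → Walk u v

  length : ∀ {u v} → Walk u v → ℕ
  length []      = zero
  length (_ ∷ p) = suc (length p)

  sign : ∀ {u v} → Walk u v → Sign
  sign []      = Sign.+
  sign (e ∷ p) = σ e *ˢ sign p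

  -- p is a shortest u-v walk (hence a shortest path), d(u,v) = length p
  Shortest : ∀ {u v} → Walk u v → Set
  Shortest {u} {v} p = ∀ (q : Walk u v) → length p ≤ length q

  -- d_Σ(u,v) = z : z = σ(P) · d(u,v) for a shortest u-v path P
  -- (well defined when all shortest u-v paths have the same sign, as in C_n^-)
  SignedDist : Fin N → Fin N → ℤ → Set
  SignedDist u v z = Σ (Walk u v) λ p → Shortest p × z ≡ (sign p Data.Integer.◃ length p)

  SameRep : ∀ {k} → (Fin k → Fin N) → Fin N → Fin N → Set
  SameRep W u v = ∀ i → ∃ λ z → SignedDist u (W i) z × SignedDist v (W i) z

  Resolving : ∀ {k} → (Fin k → Fin N) → Set
  Resolving W = ∀ u v → SameRep W u v → u ≡ v

  MetricDim : ℕ → Set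
  MetricDim k =
    (Σ (Fin k → Fin N) λ W → Injective _≡_ _≡_ W × Resolving W) ×
    (∀ m (W : Fin m → Fin N) → Injective _≡_ _≡_ W → Resolving W → k ≤ m)

CycleAdj : (n : ℕ) → Fin n → Fin n → Set
CycleAdj n i j = Step i j ⊎ Step j i
  where
  Step : Fin n → Fin n → Set
  Step a b = suc (toℕ a) ≡ toℕ b ⊎ (suc (toℕ a) ≡ n × toℕ b ≡ 0)

Cminus : (n : ℕ) → SignedGraph n
Cminus n = record { Adj = CycleAdj n ; σ = λ _ → Sign.- }

-- In C_n^- every shortest path between u and v has sign (-1)^d(u,v), so two vertices have the
-- same representation exactly when they have the same ordinary distances to the landmarks, where
-- d(u,v) = min(|u - v|, n - |u - v|).  One such distance fixes a position up to a reflection, and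
-- the reflections belonging to the adjacent landmarks 0 and 1 never agree, so {0, 1} resolves.
-- A single landmark w does not: its two neighbours are both at signed distance -1.
module Submission where

open import Defs
open import Data.Nat using (ℕ; zero; suc; _+_; _∸_; _⊓_; _≤_; _<_; z≤n; s≤s; s≤s⁻¹; ∣_-_∣; _<?_)
open import Data.Nat.Properties
open import Data.Fin using (Fin; toℕ; fromℕ; fromℕ<; inject₁) renaming (zero to fzero; suc to fsuc)
open import Data.Fin.Properties using (toℕ-injective; toℕ<n; toℕ-fromℕ; toℕ-fromℕ<; toℕ-inject₁)
open import Data.Integer using (∣_∣; _◃_)
open import Data.Integer.Properties using (abs-◃)
import Data.Sign as Sign
open import Data.Product using (Σ; ∃₂; _×_; _,_)
open import Data.Sum using (_⊎_; inj₁; inj₂; swap)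
open import Function.Definitions using (Injective)
open import Relation.Binary.PropositionalEquality
open import Relation.Nullary using (yes; no; contradiction)

shorterArc : ℕ → ℕ → ℕ
shorterArc n δ = δ ⊓ (n ∸ δ)

shorterArc-≤-suc : ∀ n {δ ε} → δ ≤ suc ε → ε ≤ suc δ → shorterArc n δ ≤ suc (shorterArc n ε)
shorterArc-≤-suc n {δ} {ε} δ≤1+ε ε≤1+δ = ⊓-mono-≤ δ≤1+ε (m≤n+o⇒m∸n≤o n δ n≤δ+1+[n∸ε])
  where
  open ≤-Reasoning
  n≤δ+1+[n∸ε] : n ≤ δ + suc (n ∸ ε)
  n≤δ+1+[n∸ε] = begin
    n                 ≤⟨ m≤n+m∸n n ε ⟩
    ε + (n ∸ ε)       ≤⟨ +-monoˡ-≤ (n ∸ ε) ε≤1+δ ⟩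
    suc δ + (n ∸ ε)   ≡⟨ +-suc δ (n ∸ ε) ⟨
    δ + suc (n ∸ ε)   ∎

shorterArc-complement : ∀ {n δ} → δ ≤ n → shorterArc n (n ∸ δ) ≡ shorterArc n δ
shorterArc-complement {n} {δ} δ≤n =
  trans (cong ((n ∸ δ) ⊓_) (m∸[m∸n]≡n δ≤n)) (⊓-comm (n ∸ δ) δ)

shorterArc-injective : ∀ {n δ ε} → δ ≤ n → ε ≤ n → shorterArc n δ ≡ shorterArc n ε →
                       δ ≡ ε ⊎ δ + ε ≡ n
shorterArc-injective {n} {δ} {ε} δ≤n ε≤n eq with ⊓-sel δ (n ∸ δ) | ⊓-sel ε (n ∸ ε)
... | inj₁ δ-min | inj₁ ε-min = inj₁ (trans (sym δ-min) (trans eq ε-min))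
... | inj₁ δ-min | inj₂ ε-min =
  inj₂ (trans (cong (_+ ε) (trans (sym δ-min) (trans eq ε-min))) (m∸n+n≡m ε≤n))
... | inj₂ δ-min | inj₁ ε-min =
  inj₂ (trans (cong (δ +_) (trans (sym ε-min) (trans (sym eq) δ-min))) (m+[n∸m]≡n δ≤n))
... | inj₂ δ-min | inj₂ ε-min =
  inj₁ (∸-cancelˡ-≡ δ≤n ε≤n (trans (sym δ-min) (trans eq ε-min)))

∣m-1+m∣≡1 : ∀ m → ∣ m - suc m ∣ ≡ 1
∣m-1+m∣≡1 m = trans (cong ∣ m -_∣ (+-comm 1 m)) (∣m-m+n∣≡n m 1)

∣m-o∣≤1+∣1+m-o∣ : ∀ m o → ∣ m - o ∣ ≤ suc ∣ suc m - o ∣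
∣m-o∣≤1+∣1+m-o∣ m o =
  subst (λ d → ∣ m - o ∣ ≤ d + ∣ suc m - o ∣) (∣m-1+m∣≡1 m) (∣-∣-triangle m (suc m) o)

∣1+m-o∣≤1+∣m-o∣ : ∀ m o → ∣ suc m - o ∣ ≤ suc ∣ m - o ∣
∣1+m-o∣≤1+∣m-o∣ m o =
  subst (λ d → ∣ suc m - o ∣ ≤ d + ∣ m - o ∣)
        (trans (∣-∣-comm (suc m) m) (∣m-1+m∣≡1 m)) (∣-∣-triangle (suc m) m o)

∣m-o∣≡n∸1+o : ∀ {m n o} → suc m ≡ n → o < n → ∣ m - o ∣ ≡ n ∸ suc o
∣m-o∣≡n∸1+o refl o<1+m = m≤n⇒∣n-m∣≡n∸m (s≤s⁻¹ o<1+m)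

shorterArc-0-1-injective : ∀ {n a b} → a < n → b < n →
                           shorterArc n ∣ a - 0 ∣ ≡ shorterArc n ∣ b - 0 ∣ →
                           shorterArc n ∣ a - 1 ∣ ≡ shorterArc n ∣ b - 1 ∣ → a ≡ b
shorterArc-0-1-injective {n} {a} {b} a<n b<n eq₀ eq₁ =
  separate a<n b<n (shorterArc-injective (<⇒≤ a<n) (<⇒≤ b<n)
                      (subst₂ (λ x y → shorterArc n x ≡ shorterArc n y)
                              (∣-∣-identityʳ a) (∣-∣-identityʳ b) eq₀))
                   (shorterArc-injective (≤∣-1∣ a<n) (≤∣-1∣ b<n) eq₁)
  where
  ≤∣-1∣ : ∀ {x} → x < n → ∣ x - 1 ∣ ≤ n
  ≤∣-1∣ {x} x<n = ≤-trans (∣m-n∣≤m⊔n x 1) (⊔-lub (<⇒≤ x<n) (≤-trans (s≤s z≤n) x<n))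

  separate : ∀ {x y} → x < n → y < n → x ≡ y ⊎ x + y ≡ n →
             ∣ x - 1 ∣ ≡ ∣ y - 1 ∣ ⊎ ∣ x - 1 ∣ + ∣ y - 1 ∣ ≡ n → x ≡ y
  separate _ _ (inj₁ x≡y) _ = x≡y
  separate {zero} _ y<n (inj₂ y≡n) _ = contradiction y≡n (<⇒≢ y<n)
  separate {suc x} {zero} x<n _ (inj₂ x+0≡n) _ =
    contradiction (trans (sym (+-identityʳ (suc x))) x+0≡n) (<⇒≢ x<n)
  separate {suc x} {suc y} _ _ (inj₂ _) (inj₁ x-1≡y-1) =
    cong suc (trans (sym (∣-∣-identityʳ x)) (trans x-1≡y-1 (∣-∣-identityʳ y)))
  separate {suc x} {suc y} _ _ (inj₂ x+y≡n) (inj₂ x-1+y-1≡n) =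
    contradiction (sym (trans (cong suc (sym (+-suc x y))) (trans x+y≡n (sym x+y≡n′))))
                  (m≢1+n+m (x + y) {1})
    where
    x+y≡n′ : x + y ≡ n
    x+y≡n′ = trans (cong₂ _+_ (sym (∣-∣-identityʳ x)) (sym (∣-∣-identityʳ y))) x-1+y-1≡n

module WalkProperties {N : ℕ} (G : SignedGraph N) where
  open SignedGraph G

  Reachable : ℕ → Fin N → Fin N → Set
  Reachable l u v = Σ (Walk G u v) λ p → length G p ≤ l

  reachable-refl : ∀ {u} → Reachable 0 u u
  reachable-refl = [] , z≤n

  reachable-edge : ∀ {u v} → Adj u v → Reachable 1 u v
  reachable-edge e = (e ∷ []) , ≤-refl

  reachable-trans : ∀ {l l′ u w v} → Reachable l u w → Reachable l′ w v → Reachable (l + l′) u v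
  reachable-trans {l} ([] , _) (q , q≤l′) = q , ≤-trans q≤l′ (m≤n+m _ l)
  reachable-trans ((e ∷ p) , s≤s p≤l) r with reachable-trans (p , p≤l) r
  ... | pr , pr≤ = (e ∷ pr) , s≤s pr≤

  reachable-sym : (∀ {u v} → Adj u v → Adj v u) → ∀ {l u v} → Reachable l u v → Reachable l v u
  reachable-sym adj-sym ([] , _) = [] , z≤n
  reachable-sym adj-sym {suc l} {u} {v} ((e ∷ p) , s≤s p≤l) =
    subst (λ k → Reachable k v u) (+-comm l 1)
          (reachable-trans (reachable-sym adj-sym (p , p≤l)) (reachable-edge (adj-sym e)))

  reachable-mono : ∀ {l l′ u v} → l ≤ l′ → Reachable l u v → Reachable l′ u v
  reachable-mono l≤l′ (p , p≤l) = p , ≤-trans p≤l l≤l′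

  shortest-≤ : ∀ {l u v} {p : Walk G u v} → Shortest G p → Reachable l u v → length G p ≤ l
  shortest-≤ p-shortest (q , q≤l) = ≤-trans (p-shortest q) q≤l

  edge-shortest : ∀ {u v} (e : Adj u v) → u ≢ v → Shortest G (e ∷ [])
  edge-shortest e u≢v []      = contradiction refl u≢v
  edge-shortest e u≢v (_ ∷ _) = s≤s z≤n

  neighbours-sameRep : ∀ {u v} (W : Fin 1 → Fin N) (e : Adj u (W fzero)) (e′ : Adj v (W fzero)) →
                       u ≢ W fzero → v ≢ W fzero → σ e ≡ σ e′ → SameRep G W u v
  neighbours-sameRep W e e′ u≢w v≢w σe≡σe′ fzero =
    sign G (e ∷ []) ◃ 1 ,
    ((e ∷ []) , edge-shortest e u≢w , refl) ,
    ((e′ ∷ []) , edge-shortest e′ v≢w , cong (λ s → (s Sign.* Sign.+) ◃ 1) σe≡σe′)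

module Cycle (m : ℕ) where
  n : ℕ
  n = suc m

  G : SignedGraph n
  G = Cminus n

  open WalkProperties G

  dist : Fin n → Fin n → ℕ
  dist u v = shorterArc n ∣ toℕ u - toℕ v ∣

  shorterArc-last : ∀ {x} t → suc x ≡ n → shorterArc n ∣ x - toℕ t ∣ ≡ shorterArc n (suc (toℕ t))
  shorterArc-last t 1+x≡n =
    trans (cong (shorterArc n) (∣m-o∣≡n∸1+o 1+x≡n (toℕ<n t))) (shorterArc-complement (toℕ<n t))

  dist-adjacent : ∀ {u w} t → CycleAdj n u w → dist u t ≤ suc (dist w t)
  dist-adjacent {u} {w} t (inj₁ (inj₁ 1+u≡w)) rewrite sym 1+u≡w =
    shorterArc-≤-suc n (∣m-o∣≤1+∣1+m-o∣ (toℕ u) (toℕ t)) (∣1+m-o∣≤1+∣m-o∣ (toℕ u) (toℕ t))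
  dist-adjacent {u} {w} t (inj₂ (inj₁ 1+w≡u)) rewrite sym 1+w≡u =
    shorterArc-≤-suc n (∣1+m-o∣≤1+∣m-o∣ (toℕ w) (toℕ t)) (∣m-o∣≤1+∣1+m-o∣ (toℕ w) (toℕ t))
  dist-adjacent t (inj₁ (inj₂ (1+u≡n , w≡0))) rewrite w≡0 | shorterArc-last t 1+u≡n =
    shorterArc-≤-suc n ≤-refl (m≤n⇒m≤1+n (n≤1+n (toℕ t)))
  dist-adjacent t (inj₂ (inj₂ (1+w≡n , u≡0))) rewrite u≡0 | shorterArc-last t 1+w≡n =
    shorterArc-≤-suc n (m≤n⇒m≤1+n (n≤1+n (toℕ t))) ≤-refl

  dist-≤-length : ∀ {u v} (p : Walk G u v) → dist u v ≤ length G p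
  dist-≤-length {u} []          = ≤-reflexive (cong (shorterArc n) (∣n-n∣≡0 (toℕ u)))
  dist-≤-length {v = v} (e ∷ p) = ≤-trans (dist-adjacent v e) (s≤s (dist-≤-length p))

  cycleAdj-sym : ∀ {u v} → CycleAdj n u v → CycleAdj n v u
  cycleAdj-sym = swap

  descend : ∀ j {u v : Fin n} → toℕ u ≡ j + toℕ v → Reachable j u v
  descend zero    {u} u≡v = subst (Reachable 0 u) (toℕ-injective u≡v) reachable-refl
  descend (suc j) {u} {v} u≡1+j+v =
    reachable-trans (reachable-edge step) (descend j (toℕ-fromℕ< j+v<n))
    where
    j+v<n : j + toℕ v < n
    j+v<n = <-trans (n<1+n (j + toℕ v)) (subst (_< n) u≡1+j+v (toℕ<n u))
    step : CycleAdj n u (fromℕ< j+v<n)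
    step = inj₂ (inj₁ (trans (cong suc (toℕ-fromℕ< j+v<n)) (sym u≡1+j+v)))

  reachable-by-symmetry : (f : ℕ → ℕ) →
    (∀ {u v} → toℕ v ≤ toℕ u → Reachable (f ∣ toℕ u - toℕ v ∣) u v) →
    ∀ u v → Reachable (f ∣ toℕ u - toℕ v ∣) u v
  reachable-by-symmetry f downward u v with ≤-total (toℕ v) (toℕ u)
  ... | inj₁ v≤u = downward v≤u
  ... | inj₂ u≤v = subst (λ d → Reachable (f d) u v) (∣-∣-comm (toℕ v) (toℕ u))
                         (reachable-sym cycleAdj-sym (downward u≤v))

  straight : ∀ u v → Reachable ∣ toℕ u - toℕ v ∣ u v
  straight = reachable-by-symmetry (λ d → d) λ {u} {v} v≤u →
    subst (λ d → Reachable d u v) (sym (m≤n⇒∣n-m∣≡n∸m v≤u))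
          (descend (toℕ u ∸ toℕ v) (sym (m∸n+n≡m v≤u)))

  around : ∀ u v → Reachable (n ∸ ∣ toℕ u - toℕ v ∣) u v
  around = reachable-by-symmetry (n ∸_) λ {u} {v} v≤u →
    subst (λ d → Reachable (n ∸ d) u v) (sym (m≤n⇒∣n-m∣≡n∸m v≤u))
      (reachable-mono (length-bound v≤u (s≤s⁻¹ (toℕ<n u)))
        (reachable-trans (reachable-sym cycleAdj-sym (up-to-last u))
          (reachable-trans (reachable-edge last-to-0) (reachable-sym cycleAdj-sym (down-to-0 v)))))
    where
    up-to-last : ∀ u → Reachable (m ∸ toℕ u) (fromℕ m) u
    up-to-last u = descend (m ∸ toℕ u) (trans (toℕ-fromℕ m) (sym (m∸n+n≡m (s≤s⁻¹ (toℕ<n u)))))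
    last-to-0 : CycleAdj n (fromℕ m) fzero
    last-to-0 = inj₁ (inj₂ (cong suc (toℕ-fromℕ m) , refl))
    down-to-0 : ∀ v → Reachable (toℕ v) v fzero
    down-to-0 v = descend (toℕ v) (sym (+-identityʳ (toℕ v)))
    length-bound : ∀ {a b} → b ≤ a → a ≤ m → (m ∸ a) + (1 + b) ≤ n ∸ (a ∸ b)
    length-bound {a} {b} b≤a a≤m = m+n≤o⇒m≤o∸n ((m ∸ a) + (1 + b)) (≤-reflexive (begin
      (m ∸ a) + (1 + b) + (a ∸ b)   ≡⟨ +-assoc (m ∸ a) (1 + b) (a ∸ b) ⟩
      (m ∸ a) + suc (b + (a ∸ b))   ≡⟨ cong (λ x → (m ∸ a) + suc x) (m+[n∸m]≡n b≤a) ⟩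
      (m ∸ a) + suc a               ≡⟨ +-suc (m ∸ a) a ⟩
      suc ((m ∸ a) + a)             ≡⟨ cong suc (m∸n+n≡m a≤m) ⟩
      n                             ∎))
      where open ≡-Reasoning

  shortest-length : ∀ {u v} (p : Walk G u v) → Shortest G p → length G p ≡ dist u v
  shortest-length {u} {v} p p-shortest = ≤-antisym
    (⊓-glb (shortest-≤ p-shortest (straight u v)) (shortest-≤ p-shortest (around u v)))
    (dist-≤-length p)

  ∣signedDist∣≡dist : ∀ {u v z} → SignedDist G u v z → ∣ z ∣ ≡ dist u v
  ∣signedDist∣≡dist (p , p-shortest , z≡) =
    trans (cong ∣_∣ z≡) (trans (abs-◃ (sign G p) (length G p)) (shortest-length p p-shortest))

  sameRep⇒equidistant : ∀ {k} (W : Fin k → Fin n) {u v} → SameRep G W u v →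
                        ∀ i → dist u (W i) ≡ dist v (W i)
  sameRep⇒equidistant W same i with same i
  ... | _ , du , dv = trans (sym (∣signedDist∣≡dist du)) (∣signedDist∣≡dist dv)

landmarks : ∀ {k} → Fin 2 → Fin (2 + k)
landmarks fzero    = fzero
landmarks (fsuc _) = fsuc fzero

landmarks-injective : ∀ {k} → Injective _≡_ _≡_ (landmarks {k})
landmarks-injective {x = fzero}      {fzero}      _ = refl
landmarks-injective {x = fsuc fzero} {fsuc fzero} _ = refl
landmarks-injective {x = fzero}      {fsuc _}     ()
landmarks-injective {x = fsuc _}     {fzero}      ()

landmarks-resolving : ∀ k → Resolving (Cminus (2 + k)) landmarks
landmarks-resolving k u v same =
  toℕ-injective (shorterArc-0-1-injective (toℕ<n u) (toℕ<n v)
                                          (equidistant fzero) (equidistant (fsuc fzero)))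
  where
  open Cycle (suc k)
  equidistant : ∀ i → dist u (landmarks i) ≡ dist v (landmarks i)
  equidistant = sameRep⇒equidistant landmarks same

cycleAdj-irreflexive : ∀ {k} {u w : Fin (2 + k)} → CycleAdj (2 + k) u w → u ≢ w
cycleAdj-irreflexive (inj₁ (inj₁ 1+u≡u)) refl = 1+n≢n 1+u≡u
cycleAdj-irreflexive (inj₂ (inj₁ 1+u≡u)) refl = 1+n≢n 1+u≡u
cycleAdj-irreflexive (inj₁ (inj₂ (1+u≡n , u≡0))) refl =
  0≢1+n (trans (sym u≡0) (suc-injective 1+u≡n))
cycleAdj-irreflexive (inj₂ (inj₂ (1+u≡n , u≡0))) refl =
  0≢1+n (trans (sym u≡0) (suc-injective 1+u≡n))

predecessor : ∀ {k} (w : Fin (2 + k)) → CycleAdj (3 + k) (inject₁ w) (fsuc w)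
predecessor w = inj₁ (inj₁ (cong suc (toℕ-inject₁ w)))

two-neighbours : ∀ {k} (w : Fin (3 + k)) →
                 ∃₂ λ u v → CycleAdj (3 + k) u w × CycleAdj (3 + k) v w × u ≢ v
two-neighbours {k} fzero =
  fsuc fzero , fromℕ (2 + k) ,
  inj₂ (inj₁ refl) , inj₁ (inj₂ (cong suc (toℕ-fromℕ (2 + k)) , refl)) , λ ()
two-neighbours {k} (fsuc w) with 2 + toℕ w <? 3 + k
... | yes lt = fromℕ< lt , inject₁ w , inj₂ (inj₁ (sym (toℕ-fromℕ< lt))) , predecessor w , distinct
  where
  distinct : fromℕ< lt ≢ inject₁ w
  distinct eq = m≢1+n+m (toℕ w) {1}
    (sym (trans (sym (toℕ-fromℕ< lt)) (trans (cong toℕ eq) (toℕ-inject₁ w))))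
... | no ¬lt = fzero , inject₁ w , inj₂ (inj₂ (2+w≡3+k , refl)) , predecessor w , distinct
  where
  2+w≡3+k : 2 + toℕ w ≡ 3 + k
  2+w≡3+k = ≤-antisym (toℕ<n (fsuc w)) (≮⇒≥ ¬lt)
  distinct : fzero ≢ inject₁ w
  distinct eq = 0≢1+n (suc-injective (suc-injective
    (trans (cong (2 +_) (trans (cong toℕ eq) (toℕ-inject₁ w))) 2+w≡3+k)))

resolving-size-≥2 : ∀ k {m} (W : Fin m → Fin (3 + k)) → Resolving (Cminus (3 + k)) W → 2 ≤ m
resolving-size-≥2 k {zero} W resolving = contradiction (resolving fzero (fsuc fzero) λ ()) λ ()
resolving-size-≥2 k {suc zero} W resolving with two-neighbours (W fzero)
... | u , v , u~w , v~w , u≢v =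
  contradiction (resolving u v (neighbours-sameRep W u~w v~w
                                  (cycleAdj-irreflexive u~w) (cycleAdj-irreflexive v~w) refl))
                u≢v
  where open WalkProperties (Cminus (3 + k))
resolving-size-≥2 k {suc (suc m)} W resolving = s≤s (s≤s z≤n)

corollary2p5 : (n : ℕ) → 3 ≤ n → MetricDim (Cminus n) 2
corollary2p5 (suc (suc zero)) (s≤s (s≤s ()))
corollary2p5 (suc (suc (suc k))) _ =
  (landmarks , landmarks-injective , landmarks-resolving (suc k)) ,
  λ m W _ → resolving-size-≥2 k W
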